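{- Let $G$ be a planar graph with maximum degree at most four that has no packing $(1,2^{10})$-coloring, chosen with $|V(G)|+|E(G)|$ minimum among all such graphs. Then every vertex of every $3$-cycle of $G$ has degree $4$.
   Context: A set of vertices is $i$-independent if any two distinct vertices in it are at distance at least $i+1$. A packing $(1,2^{10})$-coloring of $G$ is a partition of $V(G)$ into one independent set and ten $2$-independent sets.
   Formalization: Planarity of G and of every competing graph in the minimality condition means having a polygonal plane drawing whose vertex points and arc corners have rational coordinates. -}

module Defs where

open import Data.Nat as ℕ using (ℕ; zero; suc; _<ᵇ_)
open import Data.Bool using (Bool; true; false; T; _∧_)
open import Data.Fin using (Fin; toℕ) renaming (zero to fzero)
open import Data.List using (List; []; _∷_; _++_; map; allFin; length; lookup)
open import Data.Nat.ListAction using (sum)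
open import Data.List.Relation.Unary.Any using (Any)
open import Data.Product using (Σ; Σ-syntax; ∃; ∃-syntax; _×_; _,_; proj₁; proj₂)
open import Data.Sum using (_⊎_)
open import Relation.Nullary using (¬_)
open import Relation.Binary.PropositionalEquality using (_≡_)
open import Data.Rational as ℚ using (ℚ; 0ℚ; 1ℚ)
open import Function.Definitions using (Injective)

record Graph : Set where
  field
    n     : ℕ
    adj   : Fin n → Fin n → Bool
    sym   : ∀ u v → adj u v ≡ adj v u
    irrefl : ∀ u → adj u u ≡ false
open Graph public

Adj : (G : Graph) → Fin (n G) → Fin (n G) → Set
Adj G u v = T (adj G u v)

countTrue : List Bool → ℕ
countTrue []           = 0
countTrue (true ∷ bs)  = suc (countTrue bs)
countTrue (false ∷ bs) = countTrue bs

degree : (G : Graph) → Fin (n G) → ℕ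
degree G v = countTrue (map (adj G v) (allFin (n G)))

numEdges : (G : Graph) → ℕ
numEdges G = sum (map (λ u → countTrue (map (λ v → (toℕ u <ᵇ toℕ v) ∧ adj G u v) (allFin (n G))))
                      (allFin (n G)))

size : Graph → ℕ
size G = n G ℕ.+ numEdges G

MaxDegreeAtMost : ℕ → Graph → Set
MaxDegreeAtMost d G = ∀ v → degree G v ℕ.≤ d

Dist≥2 : (G : Graph) → Fin (n G) → Fin (n G) → Set
Dist≥2 G u v = ¬ Adj G u v

Dist≥3 : (G : Graph) → Fin (n G) → Fin (n G) → Set
Dist≥3 G u v = ¬ Adj G u v × ¬ (Σ[ w ∈ Fin (n G) ] (Adj G u w × Adj G w v))

-- colour 0 : the independent set X₁; colours 1..10 : the ten 2-independent sets
IsPacking1-2^10 : (G : Graph) → (Fin (n G) → Fin 11) → Set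
IsPacking1-2^10 G c =
  ∀ u v → ¬ u ≡ v → c u ≡ c v →
    (c u ≡ fzero → Dist≥2 G u v) × (¬ c u ≡ fzero → Dist≥3 G u v)

HasPacking1-2^10 : Graph → Set
HasPacking1-2^10 G = Σ[ c ∈ (Fin (n G) → Fin 11) ] IsPacking1-2^10 G c

-- Planarity: a drawing in the plane with vertices as distinct points and
-- edges as polygonal arcs (Diestel's definition), with rational coordinates.

Point : Set
Point = ℚ × ℚ

OnSeg : Point → Point → Point → Set
OnSeg (px , py) (qx , qy) (rx , ry) =
  Σ[ t ∈ ℚ ] (0ℚ ℚ.≤ t × t ℚ.≤ 1ℚ ×
              rx ≡ px ℚ.+ t ℚ.* (qx ℚ.- px) × ry ≡ py ℚ.+ t ℚ.* (qy ℚ.- py))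

segs : List Point → List (Point × Point)
segs []           = []
segs (p ∷ [])     = []
segs (p ∷ q ∷ ps) = (p , q) ∷ segs (q ∷ ps)

OnPoly : List Point → Point → Set
OnPoly ps r = Any (λ s → OnSeg (proj₁ s) (proj₂ s) r) (segs ps)

-- The polygonal line is simple (an arc): two of its segments meet only if
-- they are consecutive, and then only in their shared corner.
SimplePoly : List Point → Set
SimplePoly ps =
  ∀ (k l : Fin (length (segs ps))) (r : Point) → toℕ k ℕ.< toℕ l →
    OnSeg (proj₁ (lookup (segs ps) k)) (proj₂ (lookup (segs ps) k)) r →
    OnSeg (proj₁ (lookup (segs ps) l)) (proj₂ (lookup (segs ps) l)) r →
    (toℕ l ≡ suc (toℕ k)) × (r ≡ proj₂ (lookup (segs ps) k))

record PlaneDrawing (G : Graph) : Set where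
  field
    pos   : Fin (n G) → Point
    bends : Fin (n G) → Fin (n G) → List Point
  -- the arc drawn for the edge {u,v} with u < v
  arc : Fin (n G) → Fin (n G) → List Point
  arc u v = pos u ∷ (bends u v ++ (pos v ∷ []))
  IsEdge : Fin (n G) → Fin (n G) → Set
  IsEdge u v = Adj G u v × toℕ u ℕ.< toℕ v
  field
    pos-injective : Injective _≡_ _≡_ pos
    arc-simple    : ∀ u v → IsEdge u v → SimplePoly (arc u v)
    arc-avoids-vertices : ∀ u v w → IsEdge u v → OnPoly (arc u v) (pos w) →
                          (w ≡ u) ⊎ (w ≡ v)
    arcs-disjoint : ∀ u v u' v' r → IsEdge u v → IsEdge u' v' →
                    ¬ (u ≡ u' × v ≡ v') →
                    OnPoly (arc u v) r → OnPoly (arc u' v') r →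
                    Σ[ w ∈ Fin (n G) ] (r ≡ pos w)

Planar : Graph → Set
Planar G = PlaneDrawing G

-- Suppose a vertex u of a triangle uvw had degree at most 3.  Its neighbours are then v, w and at most
-- one further vertex x (take x = w if there is none).  Contracting uv, i.e. deleting u and joining x
-- to v, gives a smaller graph H that is still planar (the new edge runs along the arcs x–u–v) and
-- still has maximum degree 4 (x and v trade their edge to u for the edge xv).  By minimality H has a
-- packing (1,2^10)-colouring.  Any two neighbours of u are at distance at most 2 in H, so this
-- colouring remains a packing of G − u for the distances of G.  Finally u has at most 1 + 3·3 = 10
-- vertices within distance 2 (x, and the other neighbours of v, w and x): if one of its neighbours
-- has colour 0, one of the colours 1, …, 10 is missing among them and u takes it; otherwise u takes
-- colour 0.  So G would have a packing (1,2^10)-colouring.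
module Submission where

open import Defs
open import Data.Nat using (_≤_)
open import Data.Bool using (T)
open import Data.Fin using (Fin)
open import Relation.Nullary using (¬_)
open import Relation.Binary.PropositionalEquality using (_≡_)

open import Data.Bool.Base using (Bool; true; false; _∧_; _∨_; not)
open import Data.Bool.Properties using (T-∨; T-∧; ∨-comm; ∧-comm; ∧-identityʳ)
open import Data.Empty using (⊥; ⊥-elim)
open import Data.Fin.Base using (zero; suc; toℕ; punchIn; punchOut)
open import Data.Fin.Properties
  using (_≟_; any?; ¬∀⟶∃¬; pigeonhole; toℕ-injective; punchInᵢ≢i; punchIn-punchOut; punchIn-injective)
open import Data.List.Base using (List; []; _∷_; _++_; _∷ʳ_; map; filter; reverse; length; lookup; allFin; tabulate)
open import Data.List.Properties
  using ( ++-assoc; ++-identityʳ; length-++; length-map; length-reverse; map-++; map-∘; map-id; map-tabulate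
        ; reverse-++; reverse-map; reverse-involutive; unfold-reverse; ∷ʳ-injectiveʳ; ∷-injective)
open import Data.List.Membership.Propositional using (_∈_; _∉_; lose)
open import Data.List.Membership.Propositional.Properties using (∈-++⁺ˡ; ∈-++⁺ʳ; ∈-map⁺; ∈-filter⁺; ∈-allFin)
open import Data.List.Relation.Binary.Subset.Propositional using (_⊆_)
open import Data.List.Relation.Binary.Subset.Propositional.Properties using (Any-resp-⊆)
open import Data.List.Relation.Unary.All using (All; []; _∷_)
import Data.List.Relation.Unary.All as All
open import Data.List.Relation.Unary.AllPairs using ([]; _∷_)
open import Data.List.Relation.Unary.Any using (Any; here; there)
import Data.List.Relation.Unary.Any as Any
open import Data.List.Relation.Unary.Any.Properties using (map⁻; reverse⁻; ++⁻; lookup-index)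
open import Data.List.Relation.Unary.Unique.Propositional using (Unique)
open import Data.List.Reverse using (reverseView; []; _∶_∶ʳ_)
open import Data.Nat.Base as ℕ using (ℕ; zero; suc; _+_; _<_; _<ᵇ_; z≤n; s≤s; s≤s⁻¹)
import Data.Nat.ListAction as List
open import Data.Nat.Properties
  using ( +-0-commutativeMonoid; +-comm; +-assoc; +-identityʳ; +-cancelˡ-≡; +-mono-≤; +-monoˡ-≤; +-monoʳ-≤
        ; m≤m+n; m≤n+m; m<m+n; ≤-refl; ≤-trans; ≤-reflexive; <-cmp; <-asym; <-irrefl; <⇒≱; ≤∧≢⇒<; <ᵇ⇒<; <⇒<ᵇ
        ; module ≤-Reasoning)
  renaming (_≟_ to _≟ℕ_)
open import Algebra.Properties.CommutativeMonoid.Sum +-0-commutativeMonoid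
  using (sum; sum-syntax; sum-remove; ∑-distrib-+; sum-cong-≗; sum-replicate-zero)
open import Data.Product using (Σ-syntax; _×_; _,_; proj₁; proj₂; uncurry; swap)
import Data.Product as Product
open import Data.Product.Properties using (≡-dec)
open import Data.Rational as ℚ using (ℚ; 0ℚ; 1ℚ)
import Data.Rational.Properties as ℚ
open import Data.Rational.Solver using (module +-*-Solver)
open import Data.Sum using (_⊎_; inj₁; inj₂; [_,_])
import Data.Sum as Sum
open import Function using (_∘_; Equivalence)
open import Relation.Binary.Definitions using (tri<; tri≈; tri>)
open import Relation.Binary.PropositionalEquality as ≡
  using (_≢_; refl; trans; cong; cong₂; subst; subst₂; module ≡-Reasoning)
open import Relation.Nullary using (Dec)
open import Relation.Nullary.Decidable using (⌊_⌋; toWitness; yes; no; T?; ¬?; _×-dec_)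

_==_ : ∀ {k} → Fin k → Fin k → Bool
i == j = ⌊ i ≟ j ⌋

==-refl : ∀ {k} (i : Fin k) → i == i ≡ true
==-refl i with i ≟ i
... | yes _   = refl
... | no i≢i = ⊥-elim (i≢i refl)

T-∨ʳ : ∀ x {y} → T y → T (x ∨ y)
T-∨ʳ true  _ = _
T-∨ʳ false t = t

𝟙 : Bool → ℕ
𝟙 true  = 1
𝟙 false = 0

𝟙-T : ∀ {x} → T x → 𝟙 x ≡ 1
𝟙-T {true} _ = refl

𝟙-mono : ∀ {x y} → (T x → T y) → 𝟙 x ≤ 𝟙 y
𝟙-mono {false}        _   = z≤n
𝟙-mono {true} {true}  _   = ≤-refl
𝟙-mono {true} {false} x⇒y = ⊥-elim (x⇒y _)

𝟙-∨ : ∀ x y → 𝟙 (x ∨ y) ≤ 𝟙 x + 𝟙 y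
𝟙-∨ true  _ = s≤s z≤n
𝟙-∨ false _ = ≤-refl

𝟙-∧-∨ : ∀ x y z → 𝟙 (x ∧ (y ∨ z)) ≤ 𝟙 (x ∧ y) + 𝟙 (x ∧ z)
𝟙-∧-∨ true  y z = 𝟙-∨ y z
𝟙-∧-∨ false _ _ = z≤n

𝟙-∧-split : ∀ x y → 𝟙 (x ∧ y) + 𝟙 (x ∧ not y) ≡ 𝟙 x
𝟙-∧-split true  true  = refl
𝟙-∧-split true  false = refl
𝟙-∧-split false _     = refl

𝟙-split : ∀ {x y z} → (T x → T y ⊎ T z) → 𝟙 x ≤ 𝟙 y + 𝟙 z
𝟙-split {x} {y} {z} x⇒y∨z = ≤-trans (𝟙-mono (Equivalence.from T-∨ ∘ x⇒y∨z)) (𝟙-∨ y z)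

𝟙-disjoint : ∀ {x y} → (T x → T y → ⊥) → 𝟙 x + 𝟙 y ≤ 1
𝟙-disjoint {true}  {true}  ¬both = ⊥-elim (¬both _ _)
𝟙-disjoint {true}  {false} _     = ≤-refl
𝟙-disjoint {false} {true}  _     = ≤-refl
𝟙-disjoint {false} {false} _     = z≤n

∑-mono-≤ : ∀ {k} {f g : Fin k → ℕ} → (∀ i → f i ≤ g i) → sum f ≤ sum g
∑-mono-≤ {zero}  _   = z≤n
∑-mono-≤ {suc k} f≤g = +-mono-≤ (f≤g zero) (∑-mono-≤ (f≤g ∘ suc))

term≤∑ : ∀ {k} (f : Fin k → ℕ) i → f i ≤ sum f
term≤∑ {suc k} f i = subst (f i ≤_) (≡.sym (sum-remove {i = i} f)) (m≤m+n _ _)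

∑-𝟙-== : ∀ {k} (c : Fin k) → ∑[ j < k ] 𝟙 (j == c) ≡ 1
∑-𝟙-== {suc k} c = begin
  ∑[ j < suc k ] 𝟙 (j == c)                        ≡⟨ sum-remove {i = c} (λ j → 𝟙 (j == c)) ⟩
  𝟙 (c == c) + ∑[ j < k ] 𝟙 (punchIn c j == c)     ≡⟨ cong₂ _+_ (cong 𝟙 (==-refl c)) (sum-cong-≗ (cong 𝟙 ∘ punchIn==)) ⟩
  1 + ∑[ j < k ] 0                                 ≡⟨ cong (1 +_) (sum-replicate-zero k) ⟩
  1                                                ∎
  where
  open ≡-Reasoning
  punchIn== : ∀ j → punchIn c j == c ≡ false
  punchIn== j with punchIn c j ≟ c
  ... | yes ι≡c = ⊥-elim (punchInᵢ≢i c j ι≡c)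
  ... | no _    = refl

∑-𝟙-∧-== : ∀ {k} b (c : Fin k) → ∑[ j < k ] 𝟙 (b ∧ j == c) ≡ 𝟙 b
∑-𝟙-∧-== {k} true  c = ∑-𝟙-== c
∑-𝟙-∧-== {k} false c = sum-replicate-zero k

∑-𝟙-∧-==₂ : ∀ {k} b (c : Fin k) b′ c′ → ∑[ j < k ] (𝟙 (b ∧ j == c) + 𝟙 (b′ ∧ j == c′)) ≡ 𝟙 b + 𝟙 b′
∑-𝟙-∧-==₂ b c b′ c′ = trans (∑-distrib-+ (λ j → 𝟙 (b ∧ j == c)) _) (cong₂ _+_ (∑-𝟙-∧-== b c) (∑-𝟙-∧-== b′ c′))

length≤∑𝟙 : ∀ {k} (f : Fin k → Bool) zs → Unique zs → All (T ∘ f) zs → length zs ≤ ∑[ y < k ] 𝟙 (f y)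
length≤∑𝟙 f [] _ _ = z≤n
length≤∑𝟙 {k} f (z ∷ zs) (z≢zs ∷ unique) (fz ∷ f-zs) = begin
  1 + length zs
    ≤⟨ +-mono-≤ (𝟙-mono {true} (λ _ → f-at-z)) (length≤∑𝟙 f-off-z zs unique f-off-z-zs) ⟩
  𝟙 (f z ∧ z == z) + ∑[ y < k ] 𝟙 (f-off-z y)
    ≤⟨ +-monoˡ-≤ _ (term≤∑ (λ y → 𝟙 (f y ∧ y == z)) z) ⟩
  ∑[ y < k ] 𝟙 (f y ∧ y == z) + ∑[ y < k ] 𝟙 (f-off-z y)
    ≡⟨ ≡.sym (∑-distrib-+ (λ y → 𝟙 (f y ∧ y == z)) _) ⟩
  ∑[ y < k ] (𝟙 (f y ∧ y == z) + 𝟙 (f-off-z y))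
    ≡⟨ sum-cong-≗ (λ y → 𝟙-∧-split (f y) (y == z)) ⟩
  ∑[ y < k ] 𝟙 (f y)
    ∎
  where
  open ≤-Reasoning
  f-off-z : Fin k → Bool
  f-off-z y = f y ∧ not (y == z)
  f-at-z : T (f z ∧ z == z)
  f-at-z = Equivalence.from (T-∧ {f z} {z == z}) (fz , subst T (≡.sym (==-refl z)) _)
  f-off-z-at : ∀ y → T (f y) → z ≢ y → T (f-off-z y)
  f-off-z-at y fy z≢y with y ≟ z
  ... | yes y≡z = ⊥-elim (z≢y (≡.sym y≡z))
  ... | no _    = subst T (≡.sym (∧-identityʳ (f y))) fy
  f-off-z-zs : All (T ∘ f-off-z) zs
  f-off-z-zs = All.zipWith (λ {y} (fy , z≢y) → f-off-z-at y fy z≢y) (f-zs , z≢zs)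

countTrue-tabulate : ∀ {k} (f : Fin k → Bool) → countTrue (tabulate f) ≡ ∑[ i < k ] 𝟙 (f i)
countTrue-tabulate {zero}  f = refl
countTrue-tabulate {suc k} f with f zero
... | true  = cong suc (countTrue-tabulate (f ∘ suc))
... | false = countTrue-tabulate (f ∘ suc)

countTrue-allFin : ∀ {k} (f : Fin k → Bool) → countTrue (map f (allFin k)) ≡ ∑[ i < k ] 𝟙 (f i)
countTrue-allFin f = trans (cong countTrue (map-tabulate (λ i → i) f)) (countTrue-tabulate f)

sum-tabulate : ∀ {k} (f : Fin k → ℕ) → List.sum (tabulate f) ≡ sum f
sum-tabulate {zero}  f = refl
sum-tabulate {suc k} f = cong (f zero +_) (sum-tabulate (f ∘ suc))

length-filter-T : ∀ {A : Set} (f : A → Bool) xs → length (filter (T? ∘ f) xs) ≡ countTrue (map f xs)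
length-filter-T f []       = refl
length-filter-T f (x ∷ xs) with f x
... | true  = cong suc (length-filter-T f xs)
... | false = length-filter-T f xs

unlisted : ∀ {k} (xs : List (Fin k)) → length xs < k → Σ[ y ∈ Fin k ] y ∉ xs
unlisted {k} xs |xs|<k = ¬∀⟶∃¬ k (_∈ xs) (λ y → Any.any? (y ≟_) xs) not-all-listed
  where
  not-all-listed : ¬ (∀ y → y ∈ xs)
  not-all-listed listed with i , j , i<j , same-index ← pigeonhole |xs|<k (λ y → Any.index (listed y)) =
    <-irrefl (cong toℕ (trans (lookup-index (listed i)) (trans (cong (lookup xs) same-index) (≡.sym (lookup-index (listed j)))))) i<j

degree≡∑ : ∀ G v → degree G v ≡ ∑[ j < n G ] 𝟙 (adj G v j)
degree≡∑ G v = countTrue-allFin (adj G v)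

numEdges≡∑ : ∀ G → numEdges G ≡ ∑[ i < n G ] ∑[ j < n G ] 𝟙 ((toℕ i <ᵇ toℕ j) ∧ adj G i j)
numEdges≡∑ G = begin
  List.sum (map row (allFin (n G)))  ≡⟨ cong List.sum (map-tabulate (λ i → i) row) ⟩
  List.sum (tabulate row)            ≡⟨ sum-tabulate row ⟩
  sum row                            ≡⟨ sum-cong-≗ (λ i → countTrue-allFin (λ j → (toℕ i <ᵇ toℕ j) ∧ adj G i j)) ⟩
  ∑[ i < n G ] ∑[ j < n G ] 𝟙 ((toℕ i <ᵇ toℕ j) ∧ adj G i j) ∎
  where
  open ≡-Reasoning
  row : Fin (n G) → ℕ
  row i = countTrue (map (λ j → (toℕ i <ᵇ toℕ j) ∧ adj G i j) (allFin (n G)))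

adj-sym : ∀ G {x y} → Adj G x y → Adj G y x
adj-sym G = subst T (Graph.sym G _ _)

adj⇒≢ : ∀ G {x y} → Adj G x y → x ≢ y
adj⇒≢ G {x} x~y refl = subst T (irrefl G x) x~y

Dist≤2 : (G : Graph) → Fin (n G) → Fin (n G) → Set
Dist≤2 G x y = Adj G x y ⊎ Σ[ z ∈ Fin (n G) ] (Adj G x z × Adj G z y)

Dist≥2-sym : ∀ G {x y} → Dist≥2 G x y → Dist≥2 G y x
Dist≥2-sym G far = far ∘ adj-sym G

Dist≥3-sym : ∀ G {x y} → Dist≥3 G x y → Dist≥3 G y x
Dist≥3-sym G (far , no-middle) = Dist≥2-sym G far , λ (w , y~w , w~x) → no-middle (w , adj-sym G w~x , adj-sym G y~w)

distinct-neighbours≤degree : ∀ G {u} zs → Unique zs → All (Adj G u) zs → length zs ≤ degree G u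
distinct-neighbours≤degree G {u} zs unique adjacent =
  subst (length zs ≤_) (≡.sym (degree≡∑ G u)) (length≤∑𝟙 (adj G u) zs unique adjacent)

third-neighbour : ∀ G {u v w} → degree G u ≤ 3 → Adj G u v → Adj G u w → v ≢ w →
                  Σ[ x ∈ Fin (n G) ] (Adj G u x × x ≢ v × (∀ z → Adj G u z → z ≡ v ⊎ z ≡ w ⊎ z ≡ x))
third-neighbour G {u} {v} {w} deg≤3 u~v u~w v≢w with any? (λ z → T? (adj G u z) ×-dec (¬? (z ≟ v) ×-dec ¬? (z ≟ w)))
... | no no-other = w , u~w , v≢w ∘ ≡.sym , only-v-w
  where
  only-v-w : ∀ z → Adj G u z → z ≡ v ⊎ z ≡ w ⊎ z ≡ w
  only-v-w z u~z with z ≟ v | z ≟ w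
  ... | yes z≡v | _       = inj₁ z≡v
  ... | no _    | yes z≡w = inj₂ (inj₁ z≡w)
  ... | no z≢v  | no z≢w  = ⊥-elim (no-other (z , u~z , z≢v , z≢w))
... | yes (x , u~x , x≢v , x≢w) = x , u~x , x≢v , only-v-w-x
  where
  only-v-w-x : ∀ z → Adj G u z → z ≡ v ⊎ z ≡ w ⊎ z ≡ x
  only-v-w-x z u~z with z ≟ v | z ≟ w | z ≟ x
  ... | yes z≡v | _       | _       = inj₁ z≡v
  ... | no _    | yes z≡w | _       = inj₂ (inj₁ z≡w)
  ... | no _    | no _    | yes z≡x = inj₂ (inj₂ z≡x)
  ... | no z≢v  | no z≢w  | no z≢x  = ⊥-elim (<-irrefl refl (≤-trans four≤degree deg≤3))
    where
    four≤degree : 4 ≤ degree G u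
    four≤degree = distinct-neighbours≤degree G (v ∷ w ∷ x ∷ z ∷ [])
      ( (v≢w ∷ (x≢v ∘ ≡.sym) ∷ (z≢v ∘ ≡.sym) ∷ [])
      ∷ ((x≢w ∘ ≡.sym) ∷ (z≢w ∘ ≡.sym) ∷ [])
      ∷ ((z≢x ∘ ≡.sym) ∷ [])
      ∷ [] ∷ [])
      (u~v ∷ u~w ∷ u~x ∷ u~z ∷ [])

-- Adding an edge

joins : ∀ {k} → Fin k → Fin k → Fin k → Fin k → Bool
joins p q i j = (i == p ∧ j == q) ∨ (i == q ∧ j == p)

module _ {k} {p q : Fin k} where

  joins-sym : ∀ i j → joins p q i j ≡ joins p q j i
  joins-sym i j = trans (cong₂ _∨_ (∧-comm (i == p) (j == q)) (∧-comm (i == q) (j == p))) (∨-comm (j == q ∧ i == p) _)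

  joins-irrefl : p ≢ q → ∀ i → joins p q i i ≡ false
  joins-irrefl p≢q i with i ≟ p | i ≟ q
  ... | yes refl | yes refl = ⊥-elim (p≢q refl)
  ... | yes _    | no _     = refl
  ... | no _     | yes _    = refl
  ... | no _     | no _     = refl

  joins-self : T (joins p q p q)
  joins-self rewrite ==-refl p | ==-refl q = _

  joins⇒ : ∀ {i j} → T (joins p q i j) → (i ≡ p × j ≡ q) ⊎ (i ≡ q × j ≡ p)
  joins⇒ {i} {j} = Sum.map both both ∘ Equivalence.to (T-∨ {i == p ∧ j == q})
    where
    both : ∀ {a b c d : Fin k} → T (a == b ∧ c == d) → a ≡ b × c ≡ d
    both {a} {b} {c} {d} = Product.map toWitness toWitness ∘ Equivalence.to (T-∧ {a == b} {c == d})

  ∑-joins≤1 : ∑[ i < k ] ∑[ j < k ] 𝟙 ((toℕ i <ᵇ toℕ j) ∧ joins p q i j) ≤ 1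
  ∑-joins≤1 = begin
    ∑[ i < k ] ∑[ j < k ] 𝟙 (i <ᵛ j ∧ joins p q i j)
      ≤⟨ ∑-mono-≤ (λ i → ∑-mono-≤ (λ j → 𝟙-split (which-pair i j))) ⟩
    ∑[ i < k ] ∑[ j < k ] (𝟙 ((p <ᵛ q ∧ i == p) ∧ j == q) + 𝟙 ((q <ᵛ p ∧ i == q) ∧ j == p))
      ≡⟨ sum-cong-≗ (λ i → ∑-𝟙-∧-==₂ (p <ᵛ q ∧ i == p) q (q <ᵛ p ∧ i == q) p) ⟩
    ∑[ i < k ] (𝟙 (p <ᵛ q ∧ i == p) + 𝟙 (q <ᵛ p ∧ i == q))
      ≡⟨ ∑-𝟙-∧-==₂ (p <ᵛ q) p (q <ᵛ p) q ⟩
    𝟙 (p <ᵛ q) + 𝟙 (q <ᵛ p)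
      ≤⟨ 𝟙-disjoint {p <ᵛ q} {q <ᵛ p} (λ p<q q<p → <-asym (<ᵇ⇒< (toℕ p) (toℕ q) p<q) (<ᵇ⇒< (toℕ q) (toℕ p) q<p)) ⟩
    1 ∎
    where
    open ≤-Reasoning
    _<ᵛ_ : Fin k → Fin k → Bool
    i <ᵛ j = toℕ i <ᵇ toℕ j
    at : ∀ {i j} a b → T (i <ᵛ j) → i ≡ a → j ≡ b → T ((a <ᵛ b ∧ i == a) ∧ j == b)
    at {i} {j} _ _ i<j refl refl rewrite ==-refl i | ==-refl j | ∧-identityʳ (i <ᵛ j) | ∧-identityʳ (i <ᵛ j) = i<j
    which-pair : ∀ i j → T (i <ᵛ j ∧ joins p q i j) → T ((p <ᵛ q ∧ i == p) ∧ j == q) ⊎ T ((q <ᵛ p ∧ i == q) ∧ j == p)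
    which-pair i j h with (i<j , joined) ← Equivalence.to (T-∧ {i <ᵛ j} {joins p q i j}) h with joins⇒ joined
    ... | inj₁ (i≡p , j≡q) = inj₁ (at p q i<j i≡p j≡q)
    ... | inj₂ (i≡q , j≡p) = inj₂ (at q p i<j i≡q j≡p)

addEdge : (G : Graph) (p q : Fin (n G)) → p ≢ q → Graph
addEdge G p q p≢q = record
  { n      = n G
  ; adj    = λ i j → adj G i j ∨ joins p q i j
  ; sym    = λ i j → cong₂ _∨_ (Graph.sym G i j) (joins-sym i j)
  ; irrefl = λ i → cong₂ _∨_ (irrefl G i) (joins-irrefl p≢q i)
  }

module _ (G : Graph) {p q : Fin (n G)} (p≢q : p ≢ q) where

  private
    G+pq : Graph
    G+pq = addEdge G p q p≢q

    _<ᵛ_ : Fin (n G) → Fin (n G) → Bool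
    i <ᵛ j = toℕ i <ᵇ toℕ j

  addEdge-⊇ : ∀ {i j} → Adj G i j → Adj G+pq i j
  addEdge-⊇ i~j = Equivalence.from T-∨ (inj₁ i~j)

  addEdge-joins : Adj G+pq p q
  addEdge-joins = T-∨ʳ (adj G p q) (joins-self {p = p} {q = q})

  degree-addEdge : ∀ i → degree G+pq i ≤ degree G i + (𝟙 (i == p) + 𝟙 (i == q))
  degree-addEdge i = begin
    degree G+pq i
      ≡⟨ degree≡∑ G+pq i ⟩
    ∑[ j < n G ] 𝟙 (adj G i j ∨ joins p q i j)
      ≤⟨ ∑-mono-≤ (λ j → 𝟙-∨ (adj G i j) _) ⟩
    ∑[ j < n G ] (𝟙 (adj G i j) + 𝟙 (joins p q i j))
      ≡⟨ ∑-distrib-+ (𝟙 ∘ adj G i) _ ⟩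
    ∑[ j < n G ] 𝟙 (adj G i j) + ∑[ j < n G ] 𝟙 (joins p q i j)
      ≤⟨ +-monoʳ-≤ _ (∑-mono-≤ (λ j → 𝟙-∨ (i == p ∧ j == q) _)) ⟩
    ∑[ j < n G ] 𝟙 (adj G i j) + ∑[ j < n G ] (𝟙 (i == p ∧ j == q) + 𝟙 (i == q ∧ j == p))
      ≡⟨ cong₂ _+_ (≡.sym (degree≡∑ G i)) (∑-𝟙-∧-==₂ (i == p) q (i == q) p) ⟩
    degree G i + (𝟙 (i == p) + 𝟙 (i == q))
      ∎
    where open ≤-Reasoning

  numEdges-addEdge : numEdges G+pq ≤ suc (numEdges G)
  numEdges-addEdge = begin
    numEdges G+pq
      ≡⟨ numEdges≡∑ G+pq ⟩
    ∑[ i < n G ] ∑[ j < n G ] 𝟙 (i <ᵛ j ∧ (adj G i j ∨ joins p q i j))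
      ≤⟨ ∑-mono-≤ (λ i → ∑-mono-≤ (λ j → 𝟙-∧-∨ (i <ᵛ j) (adj G i j) (joins p q i j))) ⟩
    ∑[ i < n G ] ∑[ j < n G ] (old i j + new i j)
      ≡⟨ trans (sum-cong-≗ (λ i → ∑-distrib-+ (old i) (new i))) (∑-distrib-+ (λ i → ∑[ j < n G ] old i j) _) ⟩
    ∑[ i < n G ] ∑[ j < n G ] old i j + ∑[ i < n G ] ∑[ j < n G ] new i j
      ≤⟨ +-mono-≤ (≤-reflexive (≡.sym (numEdges≡∑ G))) (∑-joins≤1 {p = p} {q = q}) ⟩
    numEdges G + 1
      ≡⟨ +-comm (numEdges G) 1 ⟩
    suc (numEdges G)
      ∎
    where
    open ≤-Reasoning
    old new : Fin (n G) → Fin (n G) → ℕ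
    old i j = 𝟙 (i <ᵛ j ∧ adj G i j)
    new i j = 𝟙 (i <ᵛ j ∧ joins p q i j)

-- Polygonal lines

Segment : Set
Segment = Point × Point

_∈ₛ_ : Point → Segment → Set
r ∈ₛ s = uncurry OnSeg s r

polyline : Point → List Point → Point → List Point
polyline a M b = a ∷ M ++ b ∷ []

module _ where

  open +-*-Solver

  private
    swap-parameter : ∀ p q t → p ℚ.+ t ℚ.* (q ℚ.- p) ≡ q ℚ.+ (1ℚ ℚ.- t) ℚ.* (p ℚ.- q)
    swap-parameter = solve 3 (λ p q t → p :+ t :* (q :- p) := q :+ (con 1ℚ :- t) :* (p :- q)) refl

    parameter-0 : ∀ p q → p ≡ p ℚ.+ 0ℚ ℚ.* (q ℚ.- p)
    parameter-0 = solve 2 (λ p q → p := p :+ con 0ℚ :* (q :- p)) refl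

    parameter-1 : ∀ p q → q ≡ p ℚ.+ 1ℚ ℚ.* (q ℚ.- p)
    parameter-1 = solve 2 (λ p q → q := p :+ con 1ℚ :* (q :- p)) refl

    0≤1 : 0ℚ ℚ.≤ 1ℚ
    0≤1 = toWitness {a? = 0ℚ ℚ.≤? 1ℚ} _

  onSeg-swap : ∀ s {r} → r ∈ₛ s → r ∈ₛ swap s
  onSeg-swap ((px , py) , (qx , qy)) (t , 0≤t , t≤1 , x≡ , y≡) =
    1ℚ ℚ.- t , 0≤1-t , 1-t≤1 , trans x≡ (swap-parameter px qx t) , trans y≡ (swap-parameter py qy t)
    where
    0≤1-t : 0ℚ ℚ.≤ 1ℚ ℚ.- t
    0≤1-t = subst (ℚ._≤ 1ℚ ℚ.- t) (ℚ.+-inverseʳ t) (ℚ.+-monoˡ-≤ (ℚ.- t) t≤1)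
    1-t≤1 : 1ℚ ℚ.- t ℚ.≤ 1ℚ
    1-t≤1 = subst (1ℚ ℚ.- t ℚ.≤_) (ℚ.+-identityʳ 1ℚ) (ℚ.+-monoʳ-≤ 1ℚ (ℚ.neg-antimono-≤ 0≤t))

  onSeg-start : ∀ p q → p ∈ₛ (p , q)
  onSeg-start (px , py) (qx , qy) = 0ℚ , ℚ.≤-refl , 0≤1 , parameter-0 px qx , parameter-0 py qy

  onSeg-end : ∀ p q → q ∈ₛ (p , q)
  onSeg-end (px , py) (qx , qy) = 1ℚ , 0≤1 , ℚ.≤-refl , parameter-1 px qx , parameter-1 py qy

-- SimplePoly with positions in the list of segments in place of indices.
Simple : List Segment → Set
Simple S = ∀ S₁ s S₂ t S₃ → S ≡ S₁ ++ s ∷ S₂ ++ t ∷ S₃ → ∀ {r} → r ∈ₛ s → r ∈ₛ t → S₂ ≡ [] × r ≡ proj₂ s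

module _ {A : Set} where

  length≡0 : {xs : List A} → length xs ≡ 0 → xs ≡ []
  length≡0 {[]} _ = refl

  ∈-split : ∀ {xs : List A} ys {y} zs → xs ≡ ys ++ y ∷ zs → y ∈ xs
  ∈-split ys zs refl = ∈-++⁺ʳ ys (here refl)

  position : ∀ {S : List A} xs y ys → S ≡ xs ++ y ∷ ys → Σ[ k ∈ Fin (length S) ] (toℕ k ≡ length xs × lookup S k ≡ y)
  position []       y ys refl = zero , refl , refl
  position (x ∷ xs) y ys refl with k , k≡ , S[k]≡y ← position xs y ys refl = suc k , cong suc k≡ , S[k]≡y

  split-at : ∀ (S : List A) k → Σ[ xs ∈ List A ] Σ[ ys ∈ List A ] (S ≡ xs ++ lookup S k ∷ ys × toℕ k ≡ length xs)
  split-at (x ∷ S) zero    = [] , S , refl , refl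
  split-at (x ∷ S) (suc k) with xs , ys , eq , k≡ ← split-at S k = x ∷ xs , ys , cong (x ∷_) eq , cong suc k≡

  split-at₂ : ∀ (S : List A) k l → toℕ k < toℕ l →
              Σ[ S₁ ∈ List A ] Σ[ S₂ ∈ List A ] Σ[ S₃ ∈ List A ]
                (S ≡ S₁ ++ lookup S k ∷ S₂ ++ lookup S l ∷ S₃ × toℕ k ≡ length S₁ × toℕ l ≡ suc (length S₁ + length S₂))
  split-at₂ (x ∷ S) zero (suc l) _ with S₂ , S₃ , eq , l≡ ← split-at S l = [] , S₂ , S₃ , cong (x ∷_) eq , refl , cong suc l≡
  split-at₂ (x ∷ S) (suc k) (suc l) (s≤s k<l) with S₁ , S₂ , S₃ , eq , k≡ , l≡ ← split-at₂ S k l k<l =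
    x ∷ S₁ , S₂ , S₃ , cong (x ∷_) eq , cong suc k≡ , cong suc l≡

  ++-split : ∀ (xs ys zs ws : List A) → xs ++ ys ≡ zs ++ ws →
             (Σ[ M ∈ List A ] (zs ≡ xs ++ M × ys ≡ M ++ ws)) ⊎ (Σ[ M ∈ List A ] (xs ≡ zs ++ M × ws ≡ M ++ ys))
  ++-split []       ys zs       ws eq = inj₁ (zs , refl , eq)
  ++-split (x ∷ xs) ys []       ws eq = inj₂ (x ∷ xs , refl , ≡.sym eq)
  ++-split (x ∷ xs) ys (z ∷ zs) ws eq with refl , eq′ ← ∷-injective eq with ++-split xs ys zs ws eq′
  ... | inj₁ (M , zs≡ , ys≡) = inj₁ (M , cong (x ∷_) zs≡ , ys≡)
  ... | inj₂ (M , xs≡ , ws≡) = inj₂ (M , cong (x ∷_) xs≡ , ws≡)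

simplePoly⇒Simple : ∀ ps → SimplePoly ps → Simple (segs ps)
simplePoly⇒Simple ps simple S₁ s S₂ t S₃ eq {r} r∈s r∈t
  with k , k≡ , S[k]≡s ← position S₁ s (S₂ ++ t ∷ S₃) eq
     | l , l≡ , S[l]≡t ← position (S₁ ++ s ∷ S₂) t S₃ (trans eq (≡.sym (++-assoc S₁ (s ∷ S₂) (t ∷ S₃))))
  = S₂≡[] , trans (proj₂ consecutive) (cong proj₂ S[k]≡s)
  where
  l≡′ : toℕ l ≡ length S₁ + suc (length S₂)
  l≡′ = trans l≡ (length-++ S₁)
  k<l : toℕ k < toℕ l
  k<l = subst₂ _<_ (≡.sym k≡) (≡.sym l≡′) (m<m+n (length S₁) (s≤s z≤n))
  consecutive : toℕ l ≡ suc (toℕ k) × r ≡ proj₂ (lookup (segs ps) k)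
  consecutive = simple k l r k<l (subst (r ∈ₛ_) (≡.sym S[k]≡s) r∈s) (subst (r ∈ₛ_) (≡.sym S[l]≡t) r∈t)
  S₂≡[] : S₂ ≡ []
  S₂≡[] = length≡0 (cong ℕ.pred (+-cancelˡ-≡ (length S₁) (suc (length S₂)) 1
            (trans (≡.sym l≡′) (trans (proj₁ consecutive) (trans (cong suc k≡) (+-comm 1 (length S₁)))))))

Simple⇒simplePoly : ∀ ps → Simple (segs ps) → SimplePoly ps
Simple⇒simplePoly ps simple k l r k<l r∈S[k] r∈S[l]
  with S₁ , S₂ , S₃ , eq , k≡ , l≡ ← split-at₂ (segs ps) k l k<l
  with refl , r≡ ← simple S₁ _ S₂ _ S₃ eq r∈S[k] r∈S[l]
  = trans l≡ (cong suc (trans (+-identityʳ (length S₁)) (≡.sym k≡))) , r≡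

segs-++ : ∀ xs p ys → segs (xs ++ p ∷ ys) ≡ segs (xs ∷ʳ p) ++ segs (p ∷ ys)
segs-++ []           p ys = refl
segs-++ (x ∷ [])     p ys = refl
segs-++ (x ∷ y ∷ xs) p ys = cong ((x , y) ∷_) (segs-++ (y ∷ xs) p ys)

segs-chained : ∀ ps S₁ s t S₂ → segs ps ≡ S₁ ++ s ∷ t ∷ S₂ → proj₂ s ≡ proj₁ t
segs-chained (p ∷ q ∷ r ∷ ps) []       _ _ _  refl = refl
segs-chained (p ∷ q ∷ ps)     (_ ∷ S₁) s t S₂ eq   = segs-chained (q ∷ ps) S₁ s t S₂ (proj₂ (∷-injective eq))

flipped : List Segment → List Segment
flipped S = reverse (map swap S)

flipped-∷ : ∀ A s B → flipped (A ++ s ∷ B) ≡ flipped B ++ swap s ∷ flipped A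
flipped-∷ A s B = begin
  reverse (map swap (A ++ s ∷ B))                ≡⟨ cong reverse (map-++ swap A (s ∷ B)) ⟩
  reverse (map swap A ++ swap s ∷ map swap B)    ≡⟨ reverse-++ (map swap A) (swap s ∷ map swap B) ⟩
  reverse (swap s ∷ map swap B) ++ flipped A     ≡⟨ cong (_++ flipped A) (unfold-reverse (swap s) (map swap B)) ⟩
  (flipped B ∷ʳ swap s) ++ flipped A             ≡⟨ ++-assoc (flipped B) (swap s ∷ []) (flipped A) ⟩
  flipped B ++ swap s ∷ flipped A                ∎
  where open ≡-Reasoning

flipped-involutive : ∀ S → flipped (flipped S) ≡ S
flipped-involutive S = begin
  reverse (map swap (reverse (map swap S)))   ≡⟨ cong reverse (reverse-map swap (map swap S)) ⟩
  reverse (reverse (map swap (map swap S)))   ≡⟨ reverse-involutive (map swap (map swap S)) ⟩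
  map swap (map swap S)                       ≡⟨ ≡.sym (map-∘ S) ⟩
  map (swap ∘ swap) S                         ≡⟨ map-id S ⟩
  S                                           ∎
  where open ≡-Reasoning

flipped≡[] : ∀ S → flipped S ≡ [] → S ≡ []
flipped≡[] S eq = length≡0 (trans (≡.sym (trans (length-reverse (map swap S)) (length-map swap S))) (cong length eq))

segs-reverse : ∀ ps → segs (reverse ps) ≡ flipped (segs ps)
segs-reverse []           = refl
segs-reverse (p ∷ [])     = refl
segs-reverse (p ∷ q ∷ qs) = begin
  segs (reverse (p ∷ q ∷ qs))               ≡⟨ cong segs (trans (unfold-reverse p (q ∷ qs)) (cong (_∷ʳ p) (unfold-reverse q qs))) ⟩
  segs ((reverse qs ∷ʳ q) ∷ʳ p)             ≡⟨ cong segs (++-assoc (reverse qs) (q ∷ []) (p ∷ [])) ⟩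
  segs (reverse qs ++ q ∷ p ∷ [])           ≡⟨ segs-++ (reverse qs) q (p ∷ []) ⟩
  segs (reverse qs ∷ʳ q) ++ (q , p) ∷ []    ≡⟨ cong (λ xs → segs xs ++ (q , p) ∷ []) (≡.sym (unfold-reverse q qs)) ⟩
  segs (reverse (q ∷ qs)) ++ (q , p) ∷ []   ≡⟨ cong (_++ (q , p) ∷ []) (segs-reverse (q ∷ qs)) ⟩
  flipped (segs (q ∷ qs)) ++ (q , p) ∷ []   ≡⟨ ≡.sym (flipped-∷ [] (p , q) (segs (q ∷ qs))) ⟩
  flipped (segs (p ∷ q ∷ qs))               ∎
  where open ≡-Reasoning

Simple-flipped : ∀ ps → Simple (segs ps) → Simple (flipped (segs ps))
Simple-flipped ps simple S₁ s S₂ t S₃ eq {r} r∈s r∈t = flipped≡[] S₂ (proj₁ consecutive) , trans (proj₂ consecutive) joint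
  where
  open ≡-Reasoning
  eq′ : segs ps ≡ flipped S₃ ++ swap t ∷ flipped S₂ ++ swap s ∷ flipped S₁
  eq′ = begin
    segs ps                                                       ≡⟨ ≡.sym (flipped-involutive (segs ps)) ⟩
    flipped (flipped (segs ps))                                   ≡⟨ cong flipped eq ⟩
    flipped (S₁ ++ s ∷ S₂ ++ t ∷ S₃)                              ≡⟨ flipped-∷ S₁ s (S₂ ++ t ∷ S₃) ⟩
    flipped (S₂ ++ t ∷ S₃) ++ swap s ∷ flipped S₁                 ≡⟨ cong (_++ swap s ∷ flipped S₁) (flipped-∷ S₂ t S₃) ⟩
    (flipped S₃ ++ swap t ∷ flipped S₂) ++ swap s ∷ flipped S₁    ≡⟨ ++-assoc (flipped S₃) (swap t ∷ flipped S₂) _ ⟩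
    flipped S₃ ++ swap t ∷ flipped S₂ ++ swap s ∷ flipped S₁      ∎
  consecutive : flipped S₂ ≡ [] × r ≡ proj₁ t
  consecutive = simple (flipped S₃) (swap t) (flipped S₂) (swap s) (flipped S₁) eq′ (onSeg-swap t r∈t) (onSeg-swap s r∈s)
  joint : proj₁ t ≡ proj₂ s
  joint = segs-chained ps (flipped S₃) (swap t) (swap s) (flipped S₁)
            (subst (λ X → segs ps ≡ flipped S₃ ++ swap t ∷ X ++ swap s ∷ flipped S₁) (proj₁ consecutive) eq′)

Simple-reverse : ∀ ps → Simple (segs ps) → Simple (segs (reverse ps))
Simple-reverse ps = subst Simple (≡.sym (segs-reverse ps)) ∘ Simple-flipped ps

onPoly-reverse : ∀ ps {r} → OnPoly (reverse ps) r → OnPoly ps r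
onPoly-reverse ps {r} on rewrite segs-reverse ps = Any.map (λ {s} → onSeg-swap (swap s)) (map⁻ {P = r ∈ₛ_} (reverse⁻ on))

reverse-polyline : ∀ a M b → reverse (polyline a M b) ≡ polyline b (reverse M) a
reverse-polyline a M b = begin
  reverse (a ∷ M ++ b ∷ [])          ≡⟨ unfold-reverse a (M ++ b ∷ []) ⟩
  reverse (M ++ b ∷ []) ∷ʳ a         ≡⟨ cong (_∷ʳ a) (reverse-++ M (b ∷ [])) ⟩
  b ∷ reverse M ∷ʳ a                 ∎
  where open ≡-Reasoning

OnlyOnLast : Point → List Segment → Set
OnlyOnLast p S = ∀ S₁ s X → S ≡ S₁ ++ s ∷ X → p ∈ₛ s → X ≡ [] × proj₂ s ≡ p

OnlyOnFirst : Point → List Segment → Set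
OnlyOnFirst p S = ∀ Y t S₃ → S ≡ Y ++ t ∷ S₃ → p ∈ₛ t → Y ≡ []

Simple-init : ∀ S d → Simple (S ∷ʳ d) → Simple S
Simple-init S d simple S₁ s S₂ t S₃ eq = simple S₁ s S₂ t (S₃ ∷ʳ d) (begin
  S ∷ʳ d                           ≡⟨ cong (_∷ʳ d) eq ⟩
  (S₁ ++ s ∷ S₂ ++ t ∷ S₃) ∷ʳ d    ≡⟨ ++-assoc S₁ (s ∷ S₂ ++ t ∷ S₃) (d ∷ []) ⟩
  S₁ ++ s ∷ (S₂ ++ t ∷ S₃) ∷ʳ d    ≡⟨ cong (λ X → S₁ ++ s ∷ X) (++-assoc S₂ (t ∷ S₃) (d ∷ [])) ⟩
  S₁ ++ s ∷ S₂ ++ t ∷ S₃ ∷ʳ d      ∎)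
  where open ≡-Reasoning

Simple-tail : ∀ d S → Simple (d ∷ S) → Simple S
Simple-tail d S simple S₁ s S₂ t S₃ eq = simple (d ∷ S₁) s S₂ t S₃ (cong (d ∷_) eq)

last-only : ∀ pre m p → m ≢ p → Simple (segs (pre ++ m ∷ p ∷ [])) → OnlyOnLast p (segs (pre ++ m ∷ p ∷ []))
last-only pre m p m≢p simple S₁ s X eq p∈s with reverseView X
... | [] = refl , cong proj₂ (≡.sym (∷ʳ-injectiveʳ (segs (pre ∷ʳ m)) S₁ (trans (≡.sym (segs-++ pre m (p ∷ []))) eq)))
... | X₀ ∶ _ ∶ʳ l = ⊥-elim (m≢p (≡.sym (trans (proj₂ consecutive) (trans joint (cong proj₁ (≡.sym l≡))))))
  where
  l≡ : (m , p) ≡ l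
  l≡ = ∷ʳ-injectiveʳ (segs (pre ∷ʳ m)) (S₁ ++ s ∷ X₀)
         (trans (≡.sym (segs-++ pre m (p ∷ []))) (trans eq (≡.sym (++-assoc S₁ (s ∷ X₀) (l ∷ [])))))
  consecutive : X₀ ≡ [] × p ≡ proj₂ s
  consecutive = simple S₁ s X₀ l [] eq p∈s (subst (p ∈ₛ_) l≡ (onSeg-end m p))
  joint : proj₂ s ≡ proj₁ l
  joint = segs-chained (pre ++ m ∷ p ∷ []) S₁ s l []
            (subst (λ Y → segs (pre ++ m ∷ p ∷ []) ≡ S₁ ++ s ∷ Y ++ l ∷ []) (proj₁ consecutive) eq)

first-only : ∀ p q rest → q ≢ p → Simple (segs (p ∷ q ∷ rest)) → OnlyOnFirst p (segs (p ∷ q ∷ rest))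
first-only p q rest q≢p simple []      t S₃ eq p∈t = refl
first-only p q rest q≢p simple (y ∷ Y) t S₃ eq p∈t with refl , eq′ ← ∷-injective eq =
  ⊥-elim (q≢p (≡.sym (proj₂ (simple [] (p , q) Y t S₃ (cong ((p , q) ∷_) eq′) (onSeg-start p q) p∈t))))

_≟ₚ_ : (p q : Point) → Dec (p ≡ q)
_≟ₚ_ = ≡-dec ℚ._≟_ ℚ._≟_

record TrimmedAtEnd (a : Point) (M : List Point) (p : Point) : Set where
  constructor trimmed
  field
    inner     : List Point
    simple    : Simple (segs (polyline a inner p))
    only-last : OnlyOnLast p (segs (polyline a inner p))
    sub       : segs (polyline a inner p) ⊆ segs (polyline a M p)

record TrimmedAtStart (p : Point) (N : List Point) (b : Point) : Set where
  constructor trimmed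
  field
    inner      : List Point
    simple     : Simple (segs (polyline p inner b))
    only-first : OnlyOnFirst p (segs (polyline p inner b))
    sub        : segs (polyline p inner b) ⊆ segs (polyline p N b)

-- A final degenerate segment (p , p) also meets the segment before it in p; dropping it is enough.
trim-end : ∀ a M p → a ≢ p → Simple (segs (polyline a M p)) → TrimmedAtEnd a M p
trim-end a M p a≢p simple with reverseView M
... | [] = trimmed [] simple (last-only [] a p a≢p simple) (λ s∈ → s∈)
... | M₀ ∶ _ ∶ʳ m with m ≟ₚ p
...   | no m≢p = trimmed (M₀ ∷ʳ m) simple only-last (λ s∈ → s∈)
  where
  regroup : polyline a (M₀ ∷ʳ m) p ≡ (a ∷ M₀) ++ m ∷ p ∷ []
  regroup = cong (a ∷_) (++-assoc M₀ (m ∷ []) (p ∷ []))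
  only-last : OnlyOnLast p (segs (polyline a (M₀ ∷ʳ m) p))
  only-last = subst (OnlyOnLast p ∘ segs) (≡.sym regroup) (last-only (a ∷ M₀) m p m≢p (subst (Simple ∘ segs) regroup simple))
...   | yes refl = trimmed M₀ (Simple-init _ (m , m) simple′) only-last (subst (_ ∈_) (≡.sym segs≡) ∘ ∈-++⁺ˡ)
  where
  segs≡ : segs (polyline a (M₀ ∷ʳ m) m) ≡ segs (polyline a M₀ m) ∷ʳ (m , m)
  segs≡ = trans (cong (segs ∘ (a ∷_)) (++-assoc M₀ (m ∷ []) (m ∷ []))) (segs-++ (a ∷ M₀) m (m ∷ []))
  simple′ : Simple (segs (polyline a M₀ m) ∷ʳ (m , m))
  simple′ = subst Simple segs≡ simple
  only-last : OnlyOnLast m (segs (polyline a M₀ m))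
  only-last S₁ s X eq m∈s = Product.map₂ ≡.sym
    (simple′ S₁ s X (m , m) [] (trans (cong (_∷ʳ (m , m)) eq) (++-assoc S₁ (s ∷ X) ((m , m) ∷ []))) m∈s (onSeg-start m m))

trim-start : ∀ p N b → b ≢ p → Simple (segs (polyline p N b)) → TrimmedAtStart p N b
trim-start p [] b b≢p simple = trimmed [] simple (first-only p b [] b≢p simple) (λ s∈ → s∈)
trim-start p (n₀ ∷ N) b b≢p simple with n₀ ≟ₚ p
... | no n₀≢p = trimmed (n₀ ∷ N) simple (first-only p n₀ (N ++ b ∷ []) n₀≢p simple) (λ s∈ → s∈)
... | yes refl = trimmed N (Simple-tail (p , p) _ simple) only-first there
  where
  only-first : OnlyOnFirst p (segs (polyline p N b))
  only-first Y t S₃ eq p∈t = proj₁ (simple [] (p , p) Y t S₃ (cong ((p , p) ∷_) eq) (onSeg-start p p) p∈t)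

module _ {SA SB : List Segment} {p : Point} (simpleA : Simple SA) (simpleB : Simple SB)
         (only-lastA : OnlyOnLast p SA) (only-firstB : OnlyOnFirst p SB)
         (meet-at-p : ∀ {s t r} → s ∈ SA → t ∈ SB → r ∈ₛ s → r ∈ₛ t → r ≡ p) where

  private
    across : ∀ {S₁ s S₂ t S₃ r} X Y → SA ≡ S₁ ++ s ∷ X → SB ≡ Y ++ t ∷ S₃ → S₂ ≡ X ++ Y →
             r ∈ₛ s → r ∈ₛ t → S₂ ≡ [] × r ≡ proj₂ s
    across {S₁} {s} {S₂} {t} {S₃} X Y SA≡ SB≡ S₂≡ r∈s r∈t
      with refl ← meet-at-p (∈-split S₁ X SA≡) (∈-split Y S₃ SB≡) r∈s r∈t
      with refl , s-ends-at-p ← only-lastA S₁ s X SA≡ r∈s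
      with refl ← only-firstB Y t S₃ SB≡ r∈t
      = S₂≡ , ≡.sym s-ends-at-p

    from-SA : ∀ {S₁ s S₂ t S₃ r} M → SA ≡ S₁ ++ s ∷ M → S₂ ++ t ∷ S₃ ≡ M ++ SB →
              r ∈ₛ s → r ∈ₛ t → S₂ ≡ [] × r ≡ proj₂ s
    from-SA {S₁} {s} {S₂} {t} {S₃} M SA≡ eq r∈s r∈t with ++-split S₂ (t ∷ S₃) M SB eq
    ... | inj₂ (K , S₂≡ , SB≡) = across M K SA≡ SB≡ S₂≡ r∈s r∈t
    ... | inj₁ ([] , M≡ , SB≡) =
      across M [] SA≡ (≡.sym SB≡) (trans (≡.sym (trans M≡ (++-identityʳ S₂))) (≡.sym (++-identityʳ M))) r∈s r∈t
    ... | inj₁ (t′ ∷ K , M≡ , t∷≡) with refl , _ ← ∷-injective t∷≡ =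
      simpleA S₁ s S₂ t K (trans SA≡ (cong (λ X → S₁ ++ s ∷ X) M≡)) r∈s r∈t

  Simple-++ : Simple (SA ++ SB)
  Simple-++ S₁ s S₂ t S₃ eq r∈s r∈t with ++-split SA SB S₁ (s ∷ S₂ ++ t ∷ S₃) eq
  ... | inj₁ (M , _ , SB≡)       = simpleB M s S₂ t S₃ SB≡ r∈s r∈t
  ... | inj₂ ([] , _ , SB≡)      = simpleB [] s S₂ t S₃ (≡.sym SB≡) r∈s r∈t
  ... | inj₂ (s′ ∷ M , SA≡ , s∷≡) with refl , rest ← ∷-injective s∷≡ = from-SA M SA≡ rest r∈s r∈t

-- Drawings

record Route {K : Graph} (D : PlaneDrawing K) (p q : Fin (n K)) : Set where
  open PlaneDrawing D
  field
    corners                : List Point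
    simple                 : SimplePoly (polyline (pos p) corners (pos q))
    avoids-vertices        : ∀ w → OnPoly (polyline (pos p) corners (pos q)) (pos w) → w ≡ p ⊎ w ≡ q
    meets-arcs-in-vertices : ∀ i j r → IsEdge i j → OnPoly (polyline (pos p) corners (pos q)) r → OnPoly (arc i j) r →
                             Σ[ w ∈ Fin (n K) ] r ≡ pos w

-- An arc is stored from its smaller endpoint to its larger one, and either of p, q may be the
-- smaller: hence a route in each direction.
module _ {K : Graph} {p q : Fin (n K)} (p≢q : p ≢ q) (D : PlaneDrawing K) (R : Route D p q) (R′ : Route D q p) where

  open PlaneDrawing D

  private
    K+pq : Graph
    K+pq = addEdge K p q p≢q

    data EdgeKind : Fin (n K) → Fin (n K) → Set where
      new  : EdgeKind p q
      new′ : EdgeKind q p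
      old  : ∀ {i j} → joins p q i j ≡ false → EdgeKind i j

    edgeKind : ∀ i j → EdgeKind i j
    edgeKind i j with joins p q i j in eq
    ... | false = old eq
    ... | true with joins⇒ {p = p} {q = q} {i} {j} (subst T (≡.sym eq) _)
    ...   | inj₁ (refl , refl) = new
    ...   | inj₂ (refl , refl) = new′

    bendsFor : ∀ {i j} → EdgeKind i j → List Point
    bendsFor new             = Route.corners R
    bendsFor new′            = Route.corners R′
    bendsFor {i} {j} (old _) = bends i j

    old-edge : ∀ {i j} → joins p q i j ≡ false → Adj K+pq i j × toℕ i < toℕ j → IsEdge i j
    old-edge not-joined (i~j , i<j) with Equivalence.to T-∨ i~j
    ... | inj₁ i~j′   = i~j′ , i<j
    ... | inj₂ joined = ⊥-elim (subst T not-joined joined)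

    simpleFor : ∀ {i j} (k : EdgeKind i j) → Adj K+pq i j × toℕ i < toℕ j → SimplePoly (polyline (pos i) (bendsFor k) (pos j))
    simpleFor new               _ = Route.simple R
    simpleFor new′              _ = Route.simple R′
    simpleFor {i} {j} (old nj) e = arc-simple i j (old-edge nj e)

    avoidsFor : ∀ {i j} (k : EdgeKind i j) w → Adj K+pq i j × toℕ i < toℕ j →
                OnPoly (polyline (pos i) (bendsFor k) (pos j)) (pos w) → w ≡ i ⊎ w ≡ j
    avoidsFor new               w _ = Route.avoids-vertices R w
    avoidsFor new′              w _ = Route.avoids-vertices R′ w
    avoidsFor {i} {j} (old nj) w e = arc-avoids-vertices i j w (old-edge nj e)

    disjointFor : ∀ {i j i′ j′} (k : EdgeKind i j) (k′ : EdgeKind i′ j′) r →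
                  Adj K+pq i j × toℕ i < toℕ j → Adj K+pq i′ j′ × toℕ i′ < toℕ j′ → ¬ (i ≡ i′ × j ≡ j′) →
                  OnPoly (polyline (pos i) (bendsFor k) (pos j)) r → OnPoly (polyline (pos i′) (bendsFor k′) (pos j′)) r →
                  Σ[ w ∈ Fin (n K) ] r ≡ pos w
    disjointFor new      new       _ _         _         different = ⊥-elim (different (refl , refl))
    disjointFor new′     new′      _ _         _         different = ⊥-elim (different (refl , refl))
    disjointFor new      new′      _ (_ , p<q) (_ , q<p) _         = ⊥-elim (<-asym p<q q<p)
    disjointFor new′     new       _ (_ , q<p) (_ , p<q) _         = ⊥-elim (<-asym p<q q<p)
    disjointFor new      (old nj)  r _ e _ on on′ = Route.meets-arcs-in-vertices R  _ _ r (old-edge nj e) on on′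
    disjointFor new′     (old nj)  r _ e _ on on′ = Route.meets-arcs-in-vertices R′ _ _ r (old-edge nj e) on on′
    disjointFor (old nj) new       r e _ _ on on′ = Route.meets-arcs-in-vertices R  _ _ r (old-edge nj e) on′ on
    disjointFor (old nj) new′      r e _ _ on on′ = Route.meets-arcs-in-vertices R′ _ _ r (old-edge nj e) on′ on
    disjointFor (old nj) (old nj′) r e e′ different = arcs-disjoint _ _ _ _ r (old-edge nj e) (old-edge nj′ e′) different

  addEdge-planar : PlaneDrawing K+pq
  addEdge-planar = record
    { pos                 = pos
    ; bends               = λ i j → bendsFor (edgeKind i j)
    ; pos-injective       = pos-injective
    ; arc-simple          = λ i j → simpleFor (edgeKind i j)
    ; arc-avoids-vertices = λ i j → avoidsFor (edgeKind i j)
    ; arcs-disjoint       = λ i j i′ j′ → disjointFor (edgeKind i j) (edgeKind i′ j′)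
    }

module _ {G : Graph} (D : PlaneDrawing G) where

  open PlaneDrawing D

  record OrientedArc (X Y : Fin (n G)) : Set where
    field
      corners : List Point
      simple  : Simple (segs (polyline (pos X) corners (pos Y)))
      lo hi   : Fin (n G)
      is-edge : IsEdge lo hi
      ends    : (lo ≡ X × hi ≡ Y) ⊎ (lo ≡ Y × hi ≡ X)
      within  : ∀ {r} → OnPoly (polyline (pos X) corners (pos Y)) r → OnPoly (arc lo hi) r

  orient : ∀ {X Y} → Adj G X Y → OrientedArc X Y
  orient {X} {Y} X~Y with <-cmp (toℕ X) (toℕ Y)
  ... | tri< X<Y _ _ = record
    { corners = bends X Y
    ; simple  = simplePoly⇒Simple (arc X Y) (arc-simple X Y (X~Y , X<Y))
    ; lo      = X
    ; hi      = Y
    ; is-edge = X~Y , X<Y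
    ; ends    = inj₁ (refl , refl)
    ; within  = λ on → on
    }
  ... | tri≈ _ X≡Y _ = ⊥-elim (adj⇒≢ G X~Y (toℕ-injective X≡Y))
  ... | tri> _ _ Y<X = record
    { corners = reverse (bends Y X)
    ; simple  = subst (Simple ∘ segs) reversed (Simple-reverse (arc Y X) (simplePoly⇒Simple (arc Y X) (arc-simple Y X edge)))
    ; lo      = Y
    ; hi      = X
    ; is-edge = edge
    ; ends    = inj₂ (refl , refl)
    ; within  = onPoly-reverse (arc Y X) ∘ subst (λ ps → OnPoly ps _) (≡.sym reversed)
    }
    where
    edge : IsEdge Y X
    edge = adj-sym G X~Y , Y<X
    reversed : reverse (arc Y X) ≡ polyline (pos X) (reverse (bends Y X)) (pos Y)
    reversed = reverse-polyline (pos Y) (bends Y X) (pos X)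

  vertex-on-arc : ∀ {X Y} (A : OrientedArc X Y) z → OnPoly (arc (OrientedArc.lo A) (OrientedArc.hi A)) (pos z) → z ≡ X ⊎ z ≡ Y
  vertex-on-arc A z on with arc-avoids-vertices _ _ z (OrientedArc.is-edge A) on | OrientedArc.ends A
  ... | inj₁ z≡lo | inj₁ (lo≡X , _) = inj₁ (trans z≡lo lo≡X)
  ... | inj₂ z≡hi | inj₁ (_ , hi≡Y) = inj₂ (trans z≡hi hi≡Y)
  ... | inj₁ z≡lo | inj₂ (lo≡Y , _) = inj₂ (trans z≡lo lo≡Y)
  ... | inj₂ z≡hi | inj₂ (_ , hi≡X) = inj₁ (trans z≡hi hi≡X)

-- Deleting a vertex

punchIn-<ᵇ : ∀ {k} (u : Fin (suc k)) i j → (toℕ (punchIn u i) <ᵇ toℕ (punchIn u j)) ≡ (toℕ i <ᵇ toℕ j)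
punchIn-<ᵇ zero    i       j       = refl
punchIn-<ᵇ (suc u) zero    zero    = refl
punchIn-<ᵇ (suc u) zero    (suc j) = refl
punchIn-<ᵇ (suc u) (suc i) zero    = refl
punchIn-<ᵇ (suc u) (suc i) (suc j) = punchIn-<ᵇ u i j

edge-counted : ∀ G {x y} → Adj G x y → 1 ≤ 𝟙 ((toℕ x <ᵇ toℕ y) ∧ adj G x y) + 𝟙 ((toℕ y <ᵇ toℕ x) ∧ adj G y x)
edge-counted G {x} {y} x~y with <-cmp (toℕ x) (toℕ y)
... | tri< x<y _ _ = ≤-trans (𝟙-mono {true} (λ _ → Equivalence.from T-∧ (<⇒<ᵇ x<y , x~y))) (m≤m+n _ _)
... | tri≈ _ x≡y _ = ⊥-elim (adj⇒≢ G x~y (toℕ-injective x≡y))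
... | tri> _ _ y<x = ≤-trans (𝟙-mono {true} (λ _ → Equivalence.from T-∧ (<⇒<ᵇ y<x , adj-sym G x~y))) (m≤n+m _ _)

module Deletion {m : ℕ} (a : Fin (suc m) → Fin (suc m) → Bool)
  (a-sym : ∀ x y → a x y ≡ a y x) (a-irrefl : ∀ x → a x x ≡ false) (u : Fin (suc m)) where

  G : Graph
  G = record { n = suc m ; adj = a ; sym = a-sym ; irrefl = a-irrefl }

  ι : Fin m → Fin (suc m)
  ι = punchIn u

  G─u : Graph
  G─u = record
    { n      = m
    ; adj    = λ i j → a (ι i) (ι j)
    ; sym    = λ i j → a-sym (ι i) (ι j)
    ; irrefl = λ i → a-irrefl (ι i)
    }

  ι-< : ∀ {i j} → toℕ i < toℕ j → toℕ (ι i) < toℕ (ι j)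
  ι-< {i} {j} i<j = <ᵇ⇒< (toℕ (ι i)) (toℕ (ι j)) (subst T (≡.sym (punchIn-<ᵇ u i j)) (<⇒<ᵇ i<j))

  preimage : ∀ {z} → Adj G u z → Σ[ i ∈ Fin m ] ι i ≡ z
  preimage u~z = punchOut (adj⇒≢ G u~z) , punchIn-punchOut (adj⇒≢ G u~z)

  degree-split : ∀ y → degree G y ≡ 𝟙 (a y u) + ∑[ j < m ] 𝟙 (a y (ι j))
  degree-split y = trans (degree≡∑ G y) (sum-remove {i = u} (𝟙 ∘ a y))

  degree-ι : ∀ i → degree G (ι i) ≡ 𝟙 (a (ι i) u) + degree G─u i
  degree-ι i = trans (degree-split (ι i)) (cong (𝟙 (a (ι i) u) +_) (≡.sym (degree≡∑ G─u i)))

  numEdges-─u : ∀ {y} → Adj G u y → suc (numEdges G─u) ≤ numEdges G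
  numEdges-─u {y} u~y = begin
    1 + numEdges G─u                ≤⟨ +-monoˡ-≤ (numEdges G─u) edge-at-u ⟩
    (row u + col) + numEdges G─u    ≡⟨ +-assoc (row u) col _ ⟩
    row u + (col + numEdges G─u)    ≡⟨ cong (row u +_) (≡.sym other-rows) ⟩
    row u + ∑[ i < m ] row (ι i)    ≡⟨ ≡.sym (sum-remove {i = u} row) ⟩
    ∑[ x < suc m ] row x            ≡⟨ ≡.sym (numEdges≡∑ G) ⟩
    numEdges G                      ∎
    where
    open ≤-Reasoning
    e : Fin (suc m) → Fin (suc m) → ℕ
    e x z = 𝟙 ((toℕ x <ᵇ toℕ z) ∧ a x z)
    row : Fin (suc m) → ℕ
    row x = ∑[ z < suc m ] e x z
    col : ℕ
    col = ∑[ i < m ] e (ι i) u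
    other-rows : ∑[ i < m ] row (ι i) ≡ col + numEdges G─u
    other-rows = begin-equality
      ∑[ i < m ] row (ι i)
        ≡⟨ sum-cong-≗ (λ i → sum-remove {i = u} (e (ι i))) ⟩
      ∑[ i < m ] (e (ι i) u + ∑[ j < m ] e (ι i) (ι j))
        ≡⟨ ∑-distrib-+ (λ i → e (ι i) u) _ ⟩
      col + ∑[ i < m ] ∑[ j < m ] e (ι i) (ι j)
        ≡⟨ cong (col +_) (sum-cong-≗ (λ i → sum-cong-≗ (λ j → cong (λ b → 𝟙 (b ∧ a (ι i) (ι j))) (punchIn-<ᵇ u i j)))) ⟩
      col + ∑[ i < m ] ∑[ j < m ] 𝟙 ((toℕ i <ᵇ toℕ j) ∧ a (ι i) (ι j))
        ≡⟨ cong (col +_) (≡.sym (numEdges≡∑ G─u)) ⟩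
      col + numEdges G─u
        ∎
    k : Fin m
    k = proj₁ (preimage u~y)
    edge-at-u : 1 ≤ row u + col
    edge-at-u = begin
      1                  ≤⟨ edge-counted G u~y ⟩
      e u y + e y u      ≡⟨ cong (λ z → e u y + e z u) (≡.sym (proj₂ (preimage u~y))) ⟩
      e u y + e (ι k) u  ≤⟨ +-mono-≤ (term≤∑ (e u) y) (term≤∑ (λ i → e (ι i) u) k) ⟩
      row u + col        ∎

  module _ (D : PlaneDrawing G) where

    open PlaneDrawing D
    open OrientedArc

    lift-edge : ∀ {i j} → Adj G─u i j × toℕ i < toℕ j → IsEdge (ι i) (ι j)
    lift-edge (i~j , i<j) = i~j , ι-< i<j

    u-off-arc : ∀ {i j} → IsEdge (ι i) (ι j) → ¬ OnPoly (arc (ι i) (ι j)) (pos u)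
    u-off-arc e on with arc-avoids-vertices _ _ u e on
    ... | inj₁ u≡ιi = punchInᵢ≢i u _ (≡.sym u≡ιi)
    ... | inj₂ u≡ιj = punchInᵢ≢i u _ (≡.sym u≡ιj)

    vertex-off-u : ∀ {i j r} → IsEdge (ι i) (ι j) → OnPoly (arc (ι i) (ι j)) r →
                   Σ[ z ∈ Fin (suc m) ] r ≡ pos z → Σ[ w ∈ Fin m ] r ≡ pos (ι w)
    vertex-off-u e on (z , refl) with u ≟ z
    ... | yes refl = ⊥-elim (u-off-arc e on)
    ... | no u≢z   = punchOut u≢z , cong pos (≡.sym (punchIn-punchOut u≢z))

    drawing-─u : PlaneDrawing G─u
    drawing-─u = record
      { pos                 = pos ∘ ι
      ; bends               = λ i j → bends (ι i) (ι j)
      ; pos-injective       = λ eq → punchIn-injective u _ _ (pos-injective eq)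
      ; arc-simple          = λ i j e → arc-simple (ι i) (ι j) (lift-edge e)
      ; arc-avoids-vertices = λ i j w e on →
          Sum.map (punchIn-injective u w i) (punchIn-injective u w j) (arc-avoids-vertices (ι i) (ι j) (ι w) (lift-edge e) on)
      ; arcs-disjoint       = λ i j i′ j′ r e e′ different on on′ →
          vertex-off-u (lift-edge e) on (arcs-disjoint (ι i) (ι j) (ι i′) (ι j′) r (lift-edge e) (lift-edge e′)
            (different ∘ Product.map (punchIn-injective u i i′) (punchIn-injective u j j′)) on on′)
      }

    not-lifted-edge : ∀ {X Y} (C : OrientedArc D X Y) → lo C ≡ u ⊎ hi C ≡ u → ∀ i j → ¬ (lo C ≡ ι i × hi C ≡ ι j)
    not-lifted-edge C (inj₁ lo≡u) i j (lo≡ , _) = punchInᵢ≢i u i (trans (≡.sym lo≡) lo≡u)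
    not-lifted-edge C (inj₂ hi≡u) i j (_ , hi≡) = punchInᵢ≢i u j (trans (≡.sym hi≡) hi≡u)

    module Joining {p q : Fin m} (p≢q : p ≢ q) (A : OrientedArc D (ι p) u) (B : OrientedArc D u (ι q)) where

      open TrimmedAtEnd (trim-end (pos (ι p)) (corners A) (pos u) (punchInᵢ≢i u p ∘ pos-injective) (simple A))
        renaming (inner to MA; simple to simpleA; only-last to only-lastA; sub to subA)
      open TrimmedAtStart (trim-start (pos u) (corners B) (pos (ι q)) (punchInᵢ≢i u q ∘ pos-injective) (simple B))
        renaming (inner to NB; simple to simpleB; only-first to only-firstB; sub to subB)

      SA SB : List Segment
      SA = segs (polyline (pos (ι p)) MA (pos u))
      SB = segs (polyline (pos u) NB (pos (ι q)))

      joined : List Point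
      joined = polyline (pos (ι p)) (MA ++ pos u ∷ NB) (pos (ι q))

      segs-joined : segs joined ≡ SA ++ SB
      segs-joined = trans (cong (segs ∘ (pos (ι p) ∷_)) (++-assoc MA (pos u ∷ NB) (pos (ι q) ∷ [])))
                          (segs-++ (pos (ι p) ∷ MA) (pos u) (NB ++ pos (ι q) ∷ []))

      ιp≢ιq : ι p ≢ ι q
      ιp≢ιq = p≢q ∘ punchIn-injective u p q

      onA : ∀ {r} → Any (r ∈ₛ_) SA → OnPoly (arc (lo A) (hi A)) r
      onA = within A ∘ Any-resp-⊆ subA

      onB : ∀ {r} → Any (r ∈ₛ_) SB → OnPoly (arc (lo B) (hi B)) r
      onB = within B ∘ Any-resp-⊆ subB

      on-joined : ∀ {r} → OnPoly joined r → OnPoly (arc (lo A) (hi A)) r ⊎ OnPoly (arc (lo B) (hi B)) r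
      on-joined on = Sum.map onA onB (++⁻ SA (subst (Any _) segs-joined on))

      different-edges : ¬ (lo A ≡ lo B × hi A ≡ hi B)
      different-edges (lo≡ , hi≡) with ends A | ends B
      ... | inj₁ (loA≡ , _) | inj₁ (loB≡ , _) = punchInᵢ≢i u p (trans (≡.sym loA≡) (trans lo≡ loB≡))
      ... | inj₁ (loA≡ , _) | inj₂ (loB≡ , _) = ιp≢ιq (trans (≡.sym loA≡) (trans lo≡ loB≡))
      ... | inj₂ (_ , hiA≡) | inj₁ (_ , hiB≡) = ιp≢ιq (trans (≡.sym hiA≡) (trans hi≡ hiB≡))
      ... | inj₂ (loA≡ , _) | inj₂ (loB≡ , _) = punchInᵢ≢i u q (trans (≡.sym loB≡) (trans (≡.sym lo≡) loA≡))

      meet-at-u : ∀ {s t r} → s ∈ SA → t ∈ SB → r ∈ₛ s → r ∈ₛ t → r ≡ pos u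
      meet-at-u s∈ t∈ r∈s r∈t
        with arcs-disjoint _ _ _ _ _ (is-edge A) (is-edge B) different-edges (onA (lose s∈ r∈s)) (onB (lose t∈ r∈t))
      ... | z , refl with vertex-on-arc D A z (onA (lose s∈ r∈s)) | vertex-on-arc D B z (onB (lose t∈ r∈t))
      ... | inj₂ refl | _         = refl
      ... | _         | inj₁ refl = refl
      ... | inj₁ refl | inj₂ z≡ιq = ⊥-elim (ιp≢ιq z≡ιq)

      avoids : ∀ w → OnPoly joined (pos (ι w)) → w ≡ p ⊎ w ≡ q
      avoids w on with on-joined on
      ... | inj₁ onA′ = Sum.map (punchIn-injective u w p) (⊥-elim ∘ punchInᵢ≢i u w) (vertex-on-arc D A (ι w) onA′)
      ... | inj₂ onB′ = Sum.map (⊥-elim ∘ punchInᵢ≢i u w) (punchIn-injective u w q) (vertex-on-arc D B (ι w) onB′)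

      u-endA : lo A ≡ u ⊎ hi A ≡ u
      u-endA = Sum.swap (Sum.map proj₂ proj₁ (ends A))

      u-endB : lo B ≡ u ⊎ hi B ≡ u
      u-endB = Sum.map proj₁ proj₂ (ends B)

      meets : ∀ i j r → Adj G─u i j × toℕ i < toℕ j → OnPoly joined r → OnPoly (arc (ι i) (ι j)) r →
              Σ[ w ∈ Fin m ] r ≡ pos (ι w)
      meets i j r e on on′ with on-joined on
      ... | inj₁ onA′ = vertex-off-u (lift-edge e) on′
          (arcs-disjoint _ _ _ _ r (is-edge A) (lift-edge e) (not-lifted-edge A u-endA i j) onA′ on′)
      ... | inj₂ onB′ = vertex-off-u (lift-edge e) on′
          (arcs-disjoint _ _ _ _ r (is-edge B) (lift-edge e) (not-lifted-edge B u-endB i j) onB′ on′)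

      route : Route drawing-─u p q
      route = record
        { corners                = MA ++ pos u ∷ NB
        ; simple                 = Simple⇒simplePoly joined (subst Simple (≡.sym segs-joined)
                                     (Simple-++ simpleA simpleB only-lastA only-firstB meet-at-u))
        ; avoids-vertices        = avoids
        ; meets-arcs-in-vertices = meets
        }

    route-via-u : ∀ {p q} → p ≢ q → Adj G (ι p) u → Adj G u (ι q) → Route drawing-─u p q
    route-via-u p≢q p~u u~q = Joining.route p≢q (orient D p~u) (orient D u~q)

  IsPartialPacking : (Fin m → Fin 11) → Set
  IsPartialPacking c = ∀ i j → i ≢ j → c i ≡ c j →
    (c i ≡ zero → Dist≥2 G (ι i) (ι j)) × (c i ≢ zero → Dist≥3 G (ι i) (ι j))

  FreeAt-u : (Fin m → Fin 11) → Fin 11 → Set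
  FreeAt-u c k = ∀ j → c j ≡ k → (k ≡ zero → Dist≥2 G u (ι j)) × (k ≢ zero → Dist≥3 G u (ι j))

  extend : (Fin m → Fin 11) → Fin 11 → Fin (suc m) → Fin 11
  extend c k z with u ≟ z
  ... | yes _  = k
  ... | no u≢z = c (punchOut u≢z)

  module _ {c : Fin m → Fin 11} {k : Fin 11} (free : FreeAt-u c k) where

    private
      Packed : Fin 11 → Fin (suc m) → Fin (suc m) → Set
      Packed k′ y z = (k′ ≡ zero → Dist≥2 G y z) × (k′ ≢ zero → Dist≥3 G y z)

      from-u : ∀ z (u≢z : u ≢ z) → k ≡ c (punchOut u≢z) → Packed k u z
      from-u z u≢z k≡ = subst (Packed k u) (punchIn-punchOut u≢z) (free (punchOut u≢z) (≡.sym k≡))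

      towards-u : ∀ {k′ z} → Packed k u z → k′ ≡ k → Packed k′ z u
      towards-u (far₂ , far₃) refl = Dist≥2-sym G ∘ far₂ , Dist≥3-sym G ∘ far₃

    extend-packing : IsPartialPacking c → IsPacking1-2^10 G (extend c k)
    extend-packing partial y z y≢z same with u ≟ y | u ≟ z
    ... | yes refl | yes refl = ⊥-elim (y≢z refl)
    ... | yes refl | no u≢z   = from-u z u≢z same
    ... | no u≢y   | yes refl = towards-u (from-u y u≢y (≡.sym same)) same
    ... | no u≢y   | no u≢z   =
      subst₂ (Packed (c (punchOut u≢y))) (punchIn-punchOut u≢y) (punchIn-punchOut u≢z)
             (partial (punchOut u≢y) (punchOut u≢z) (y≢z ∘ punchOut-injective) same)
      where
      punchOut-injective : punchOut u≢y ≡ punchOut u≢z → y ≡ z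
      punchOut-injective eq = trans (≡.sym (punchIn-punchOut u≢y)) (trans (cong ι eq) (punchIn-punchOut u≢z))

  -- If a neighbour of u has colour 0, the ball uses at most 9 of the 10 other colours.
  free-colour : ∀ c (ball : List (Fin m)) → length ball ≤ 10 → (∀ i → Dist≤2 G u (ι i) → i ∈ ball) →
                Σ[ k ∈ Fin 11 ] FreeAt-u c k
  free-colour c ball |ball|≤10 covers with any? (λ i → T? (a u (ι i)) ×-dec (c i ≟ zero))
  ... | no no-neighbour-0 = zero , λ j cj≡0 → (λ _ u~ιj → no-neighbour-0 (j , u~ιj , cj≡0)) , λ 0≢0 → ⊥-elim (0≢0 refl)
  ... | yes (i , u~ιi , ci≡0) with k , k∉ ← unlisted (map c ball) (s≤s (≤-trans (≤-reflexive (length-map c ball)) |ball|≤10)) =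
    k , λ j cj≡k → (λ k≡0 → ⊥-elim (k∉ (subst (_∈ map c ball) (trans ci≡0 (≡.sym k≡0)) (listed i (inj₁ u~ιi)))))
                 , λ _ → (λ u~ιj → k∉ (subst (_∈ map c ball) cj≡k (listed j (inj₁ u~ιj))))
                       , (λ middle → k∉ (subst (_∈ map c ball) cj≡k (listed j (inj₂ middle))))
    where
    listed : ∀ j → Dist≤2 G u (ι j) → c j ∈ map c ball
    listed j near = ∈-map⁺ c (covers j near)

  neighbours-off-u : Fin (suc m) → List (Fin m)
  neighbours-off-u y = filter (λ j → T? (a y (ι j))) (allFin m)

  ∈-neighbours-off-u : ∀ {y j} → Adj G y (ι j) → j ∈ neighbours-off-u y
  ∈-neighbours-off-u {y} y~ιj = ∈-filter⁺ (λ j → T? (a y (ι j))) (∈-allFin _) y~ιj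

  length-neighbours-off-u : ∀ {y} → Adj G y u → suc (length (neighbours-off-u y)) ≡ degree G y
  length-neighbours-off-u {y} y~u = begin
    1 + length (neighbours-off-u y)
      ≡⟨ cong₂ _+_ (≡.sym (𝟙-T y~u)) (trans (length-filter-T (a y ∘ ι) (allFin m)) (countTrue-allFin (a y ∘ ι))) ⟩
    𝟙 (a y u) + ∑[ j < m ] 𝟙 (a y (ι j))
      ≡⟨ ≡.sym (degree-split y) ⟩
    degree G y
      ∎
    where open ≡-Reasoning

  module Contraction {p q : Fin m} (p≢q : p ≢ q) (p~u : Adj G (ι p) u) (q~u : Adj G (ι q) u) where

    H : Graph
    H = addEdge G─u p q p≢q

    degree-H : ∀ i → degree H i ≤ degree G (ι i)
    degree-H i = begin
      degree H i                                ≤⟨ degree-addEdge G─u p≢q i ⟩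
      degree G─u i + (𝟙 (i == p) + 𝟙 (i == q))  ≤⟨ +-monoʳ-≤ (degree G─u i) ends-at-neighbours ⟩
      degree G─u i + 𝟙 (a (ι i) u)              ≡⟨ +-comm (degree G─u i) _ ⟩
      𝟙 (a (ι i) u) + degree G─u i              ≡⟨ ≡.sym (degree-ι i) ⟩
      degree G (ι i)                            ∎
      where
      open ≤-Reasoning
      ends-at-neighbours : 𝟙 (i == p) + 𝟙 (i == q) ≤ 𝟙 (a (ι i) u)
      ends-at-neighbours with i ≟ p | i ≟ q
      ... | yes refl | yes refl = ⊥-elim (p≢q refl)
      ... | yes refl | no _     = 𝟙-mono {true} (λ _ → p~u)
      ... | no _     | yes refl = 𝟙-mono {true} (λ _ → q~u)
      ... | no _     | no _     = z≤n

    size-H : size H < size G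
    size-H = s≤s (+-monoʳ-≤ m (≤-trans (numEdges-addEdge G─u p≢q) (numEdges-─u (adj-sym G q~u))))

    planar-H : PlaneDrawing G → PlaneDrawing H
    planar-H D = addEdge-planar p≢q (drawing-─u D)
      (route-via-u D p≢q p~u (adj-sym G q~u))
      (route-via-u D (p≢q ∘ ≡.sym) q~u (adj-sym G p~u))

    packing-restricts : (∀ i j → i ≢ j → Adj G u (ι i) → Adj G u (ι j) → Dist≤2 H i j) →
                        ∀ {c} → IsPacking1-2^10 H c → IsPartialPacking c
    packing-restricts close packing i j i≢j same = Product.map (far₂ ∘_) (far₃ ∘_) (packing i j i≢j same)
      where
      far₂ : Dist≥2 H i j → Dist≥2 G (ι i) (ι j)
      far₂ far = far ∘ addEdge-⊇ G─u p≢q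
      no-middle-in-G : Dist≥2 H i j → ¬ (Σ[ k ∈ Fin m ] (Adj H i k × Adj H k j)) →
                       ¬ (Σ[ t ∈ Fin (suc m) ] (Adj G (ι i) t × Adj G t (ι j)))
      no-middle-in-G far no-middle (t , ιi~t , t~ιj) with u ≟ t
      ... | yes refl = [ far , no-middle ] (close i j i≢j (adj-sym G ιi~t) t~ιj)
      ... | no u≢t   = no-middle (punchOut u≢t , addEdge-⊇ G─u p≢q (subst (Adj G (ι i)) (≡.sym ιk≡t) ιi~t)
                                               , addEdge-⊇ G─u p≢q (subst (λ t′ → Adj G t′ (ι j)) (≡.sym ιk≡t) t~ιj))
        where
        ιk≡t : ι (punchOut u≢t) ≡ t
        ιk≡t = punchIn-punchOut u≢t
      far₃ : Dist≥3 H i j → Dist≥3 G (ι i) (ι j)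
      far₃ (far , no-middle) = far₂ far , no-middle-in-G far no-middle

  module Triangle (max4 : MaxDegreeAtMost 4 G) {v w x : Fin (suc m)}
                  (u~v : Adj G u v) (v~w : Adj G v w) (u~w : Adj G u w) (u~x : Adj G u x) (x≢v : x ≢ v)
                  (cover : ∀ z → Adj G u z → z ≡ v ⊎ z ≡ w ⊎ z ≡ x) where

    private
      v′ w′ x′ : Fin m
      v′ = proj₁ (preimage u~v)
      w′ = proj₁ (preimage u~w)
      x′ = proj₁ (preimage u~x)

      cover′ : ∀ i → Adj G u (ι i) → i ≡ v′ ⊎ i ≡ w′ ⊎ i ≡ x′
      cover′ i u~ιi = Sum.map (same-preimage u~v) (Sum.map (same-preimage u~w) (same-preimage u~x)) (cover (ι i) u~ιi)
        where
        same-preimage : ∀ {z} (u~z : Adj G u z) → ι i ≡ z → i ≡ proj₁ (preimage u~z)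
        same-preimage u~z ιi≡z = punchIn-injective u i _ (trans ιi≡z (≡.sym (proj₂ (preimage u~z))))

      x′≢v′ : x′ ≢ v′
      x′≢v′ x′≡v′ = x≢v (trans (≡.sym (proj₂ (preimage u~x))) (trans (cong ι x′≡v′) (proj₂ (preimage u~v))))

      on-u : ∀ {z} (u~z : Adj G u z) → Adj G (ι (proj₁ (preimage u~z))) u
      on-u u~z = adj-sym G (subst (Adj G u) (≡.sym (proj₂ (preimage u~z))) u~z)

    open Contraction x′≢v′ (on-u u~x) (on-u u~v)

    ball : List (Fin m)
    ball = x′ ∷ neighbours-off-u v ++ neighbours-off-u w ++ neighbours-off-u x

    length-ball : length ball ≤ 10
    length-ball = s≤s (begin
      length (neighbours-off-u v ++ neighbours-off-u w ++ neighbours-off-u x)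
        ≡⟨ trans (length-++ (neighbours-off-u v)) (cong (length (neighbours-off-u v) +_) (length-++ (neighbours-off-u w))) ⟩
      length (neighbours-off-u v) + (length (neighbours-off-u w) + length (neighbours-off-u x))
        ≤⟨ +-mono-≤ (at-most-3 u~v) (+-mono-≤ (at-most-3 u~w) (at-most-3 u~x)) ⟩
      9 ∎)
      where
      open ≤-Reasoning
      at-most-3 : ∀ {y} → Adj G u y → length (neighbours-off-u y) ≤ 3
      at-most-3 {y} u~y = s≤s⁻¹ (subst (_≤ 4) (≡.sym (length-neighbours-off-u (adj-sym G u~y))) (max4 y))

    ball-covers : ∀ i → Dist≤2 G u (ι i) → i ∈ ball
    ball-covers i (inj₁ u~ιi) with cover (ι i) u~ιi
    ... | inj₁ refl        = there (∈-++⁺ʳ (neighbours-off-u v) (∈-++⁺ˡ (∈-neighbours-off-u (adj-sym G v~w))))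
    ... | inj₂ (inj₁ refl) = there (∈-++⁺ˡ (∈-neighbours-off-u v~w))
    ... | inj₂ (inj₂ refl) = here (punchIn-injective u i x′ (≡.sym (proj₂ (preimage u~x))))
    ball-covers i (inj₂ (y , u~y , y~ιi)) with cover y u~y
    ... | inj₁ refl        = there (∈-++⁺ˡ (∈-neighbours-off-u y~ιi))
    ... | inj₂ (inj₁ refl) = there (∈-++⁺ʳ (neighbours-off-u v) (∈-++⁺ˡ (∈-neighbours-off-u y~ιi)))
    ... | inj₂ (inj₂ refl) = there (∈-++⁺ʳ (neighbours-off-u v) (∈-++⁺ʳ (neighbours-off-u w) (∈-neighbours-off-u y~ιi)))

    private
      v′~w′ : Adj H v′ w′
      v′~w′ = addEdge-⊇ G─u x′≢v′ (subst₂ (Adj G) (≡.sym (proj₂ (preimage u~v))) (≡.sym (proj₂ (preimage u~w))) v~w)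

      x′~v′ : Adj H x′ v′
      x′~v′ = addEdge-joins G─u x′≢v′

    neighbours-close : ∀ i j → i ≢ j → Adj G u (ι i) → Adj G u (ι j) → Dist≤2 H i j
    neighbours-close i j i≢j u~ιi u~ιj with cover′ i u~ιi | cover′ j u~ιj
    ... | inj₁ refl        | inj₂ (inj₁ refl) = inj₁ v′~w′
    ... | inj₂ (inj₁ refl) | inj₁ refl        = inj₁ (adj-sym H v′~w′)
    ... | inj₂ (inj₂ refl) | inj₁ refl        = inj₁ x′~v′
    ... | inj₁ refl        | inj₂ (inj₂ refl) = inj₁ (adj-sym H x′~v′)
    ... | inj₂ (inj₂ refl) | inj₂ (inj₁ refl) = inj₂ (v′ , x′~v′ , v′~w′)
    ... | inj₂ (inj₁ refl) | inj₂ (inj₂ refl) = inj₂ (v′ , adj-sym H v′~w′ , adj-sym H x′~v′)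
    ... | inj₁ refl        | inj₁ refl        = ⊥-elim (i≢j refl)
    ... | inj₂ (inj₁ refl) | inj₂ (inj₁ refl) = ⊥-elim (i≢j refl)
    ... | inj₂ (inj₂ refl) | inj₂ (inj₂ refl) = ⊥-elim (i≢j refl)

    not-minimal : Planar G → ¬ HasPacking1-2^10 G →
                  ¬ (∀ (K : Graph) → Planar K → MaxDegreeAtMost 4 K → ¬ HasPacking1-2^10 K → size G ≤ size K)
    not-minimal planar no-packing minimal = <⇒≱ size-H (minimal H (planar-H planar) max4-H no-packing-H)
      where
      max4-H : MaxDegreeAtMost 4 H
      max4-H i = ≤-trans (degree-H i) (max4 (ι i))
      no-packing-H : ¬ HasPacking1-2^10 H
      no-packing-H (c , packing) with k , free ← free-colour c ball length-ball ball-covers =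
        no-packing (extend c k , extend-packing free (packing-restricts neighbours-close packing))

lemma2p3 : (G : Graph) → Planar G → MaxDegreeAtMost 4 G → ¬ HasPacking1-2^10 G →
           (∀ (H : Graph) → Planar H → MaxDegreeAtMost 4 H → ¬ HasPacking1-2^10 H →
              size G ≤ size H) →
           ∀ (u v w : Fin (n G)) → Adj G u v → Adj G v w → Adj G w u →
           degree G u ≡ 4
lemma2p3 record { n = zero } _ _ _ _ ()
lemma2p3 G@record { n = suc m ; adj = a ; sym = a-sym ; irrefl = a-irrefl } planar max4 no-packing minimal u v w u~v v~w w~u
  with degree G u ≟ℕ 4
... | yes deg≡4 = deg≡4
... | no deg≢4
  with x , u~x , x≢v , cover ← third-neighbour G (s≤s⁻¹ (≤∧≢⇒< (max4 u) deg≢4)) u~v (adj-sym G w~u) (adj⇒≢ G v~w)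
  = ⊥-elim (Deletion.Triangle.not-minimal a a-sym a-irrefl u max4 u~v v~w (adj-sym G w~u) u~x x≢v cover planar no-packing minimal)
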